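{- For every quantified theory $Q_1x_1\cdots Q_nx_n\,\Gamma$ (with $Q_i\in\{\forall,\exists\}$, $x_i\in\mathtt{VAR}$ and $\Gamma$ a propositional theory), if $Q_1x_1\cdots Q_nx_n\,\Gamma$ is F-satisfiable then it is S-satisfiable.
   Context: Fix a nonempty set $\mathtt{VAR}$ of atoms. Formulas are generated by $\varphi,\psi ::= p \mid \bot \mid \varphi\wedge\psi \mid \varphi\vee\psi \mid \varphi\to\psi$ with $p\in\mathtt{VAR}$; $\neg\varphi$ abbreviates $\varphi\to\bot$; a theory is a set of formulas. A three-valued Gödel interpretation is a map $\bm{m}:\mathtt{VAR}\to\{0,\tfrac12,1\}$, extended to formulas by $\bm{m}(\bot)=0$, $\wedge$ as $\min$, $\vee$ as $\max$, $\bm{m}(\varphi\to\psi)=1$ if $\bm{m}(\varphi)\le\bm{m}(\psi)$ and $=\bm{m}(\psi)$ otherwise, and to theories by $\bm{m}(\Gamma)=\min_{\varphi\in\Gamma}\bm{m}(\varphi)$. The crisp interpretation $\bm{m}^{c}$ maps $p$ to $1$ if $\bm{m}(p)=\tfrac12$ and to $\bm{m}(p)$ otherwise. Write $\bm{m}\triangleleft\bm{m}'$ if $\bm{m}^{c}=\bm{m}'^{c}$, $\bm{m}(p)\le\bm{m}'(p)$ for all $p$, and $\bm{m}\neq\bm{m}'$. An equilibrium model (answer set) of $\Gamma$ is an $\bm{m}$ with $\bm{m}=\bm{m}^{c}$, $\bm{m}(\Gamma)=1$, and no $\bm{m}'\triangleleft\bm{m}$ with $\bm{m}'(\Gamma)=1$.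 A theory is satisfiable if it has an equilibrium model. F-satisfiability (semantics of Fandinno et al.) of a quantified theory is defined recursively: a quantifier-free theory $\Gamma$ is F-satisfiable iff it is satisfiable; $\exists x\,\overline{Q}\,\Gamma$ is F-satisfiable iff $\overline{Q}(\Gamma\cup\{\neg\neg x\})$ or $\overline{Q}(\Gamma\cup\{\neg x\})$ is F-satisfiable; $\forall x\,\overline{Q}\,\Gamma$ is F-satisfiable iff both $\overline{Q}(\Gamma\cup\{\neg\neg x\})$ and $\overline{Q}(\Gamma\cup\{\neg x\})$ are F-satisfiable (here $\overline{Q}$ is a possibly empty sequence of quantifiers). S-satisfiability (semantics of Stéphan) is defined identically except that $\neg\neg x$ is replaced by $x$ everywhere. -}

module Defs where

open import Data.Product using (Σ; _×_; _,_)
open import Data.Sum using (_⊎_)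
open import Data.List using (List; []; _∷_)
open import Relation.Nullary using (¬_)
open import Relation.Binary.PropositionalEquality using (_≡_)

data Formula (VAR : Set) : Set where
  atom : VAR → Formula VAR
  ⊥f   : Formula VAR
  _∧f_ : Formula VAR → Formula VAR → Formula VAR
  _∨f_ : Formula VAR → Formula VAR → Formula VAR
  _⇒f_ : Formula VAR → Formula VAR → Formula VAR

infixr 6 _∧f_
infixr 5 _∨f_
infixr 4 _⇒f_

¬f_ : {VAR : Set} → Formula VAR → Formula VAR
¬f φ = φ ⇒f ⊥f

Theory : Set → Set₁
Theory VAR = Formula VAR → Set

_∪｛_｝ : {VAR : Set} → Theory VAR → Formula VAR → Theory VAR
(Γ ∪｛ φ ｝) ψ = Γ ψ ⊎ (ψ ≡ φ)

-- Truth values {0, 1/2, 1}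
data V3 : Set where
  v0 vh v1 : V3

data _≤3_ : V3 → V3 → Set where
  0≤x : ∀ {x} → v0 ≤3 x
  h≤h : vh ≤3 vh
  h≤1 : vh ≤3 v1
  1≤1 : v1 ≤3 v1

min3 : V3 → V3 → V3
min3 v0 y  = v0
min3 vh v0 = v0
min3 vh y  = vh
min3 v1 y  = y

max3 : V3 → V3 → V3
max3 v0 y  = y
max3 vh v1 = v1
max3 vh y  = vh
max3 v1 y  = v1

-- Gödel implication: 1 if a ≤ b, else b
imp3 : V3 → V3 → V3
imp3 v0 b  = v1
imp3 vh v0 = v0
imp3 vh b  = v1
imp3 v1 b  = b

Interp : Set → Set
Interp VAR = VAR → V3

eval : {VAR : Set} → Interp VAR → Formula VAR → V3
eval m (atom p) = m p
eval m ⊥f       = v0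
eval m (φ ∧f ψ) = min3 (eval m φ) (eval m ψ)
eval m (φ ∨f ψ) = max3 (eval m φ) (eval m ψ)
eval m (φ ⇒f ψ) = imp3 (eval m φ) (eval m ψ)

-- m(Γ) = 1, i.e. min over Γ equals 1, i.e. every member of Γ evaluates to 1
Models : {VAR : Set} → Interp VAR → Theory VAR → Set
Models m Γ = ∀ φ → Γ φ → eval m φ ≡ v1

crisp3 : V3 → V3
crisp3 vh = v1
crisp3 x  = x

crisp : {VAR : Set} → Interp VAR → Interp VAR
crisp m p = crisp3 (m p)

_◁_ : {VAR : Set} → Interp VAR → Interp VAR → Set
m ◁ m' = (∀ p → crisp m p ≡ crisp m' p)
       × (∀ p → m p ≤3 m' p)
       × ¬ (∀ p → m p ≡ m' p)

Equilibrium : {VAR : Set} → Interp VAR → Theory VAR → Set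
Equilibrium m Γ = (∀ p → m p ≡ crisp m p)
                × Models m Γ
                × ¬ (Σ (Interp _) λ m' → (m' ◁ m) × Models m' Γ)

Satisfiable : {VAR : Set} → Theory VAR → Set
Satisfiable {VAR} Γ = Σ (Interp VAR) λ m → Equilibrium m Γ

data Quant : Set where
  ∀q ∃q : Quant

-- Satisfiability of a quantified theory Q₁x₁ ⋯ Qₙxₙ Γ, parametrised by the
-- formula `pos x` added in the "true" branch.
QSat : {VAR : Set} → (VAR → Formula VAR) → List (Quant × VAR) → Theory VAR → Set
QSat pos []              Γ = Satisfiable Γ
QSat pos ((∃q , x) ∷ qs) Γ = QSat pos qs (Γ ∪｛ pos x ｝) ⊎ QSat pos qs (Γ ∪｛ ¬f atom x ｝)
QSat pos ((∀q , x) ∷ qs) Γ = QSat pos qs (Γ ∪｛ pos x ｝) × QSat pos qs (Γ ∪｛ ¬f atom x ｝)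

-- F-satisfiability (Fandinno et al.): branch with ¬¬x
FSat : {VAR : Set} → List (Quant × VAR) → Theory VAR → Set
FSat = QSat (λ x → ¬f (¬f atom x))

-- S-satisfiability (Stéphan): branch with x
SSat : {VAR : Set} → List (Quant × VAR) → Theory VAR → Set
SSat = QSat atom

-- For crisp interpretations x and ¬¬x hold together, while x implies ¬¬x in
-- every interpretation. Hence if Γ' has the same crisp models as Γ and every
-- model of Γ' is a model of Γ, then every equilibrium model of Γ is one of Γ':
-- it is crisp, so it models Γ', and a ◁-smaller model of Γ' would be a
-- ◁-smaller model of Γ. This relation between theories is preserved when the
-- F-branch adds ¬¬x and the S-branch adds x, so it survives the whole
-- quantifier prefix.
module Submission where

open import Defs
open import Data.Product using (_×_; _,_)
open import Data.Sum using (inj₁; inj₂)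
open import Data.List using (List; []; _∷_)
open import Function using (id; _∘_)
open import Relation.Binary.PropositionalEquality using (_≡_; refl)

IsCrisp : {VAR : Set} → Interp VAR → Set
IsCrisp m = ∀ p → m p ≡ crisp m p

record Refines {VAR : Set} (Γ Γ' : Theory VAR) : Set where
  field
    models-weaker  : ∀ m → Models m Γ' → Models m Γ
    crisp-stronger : ∀ m → IsCrisp m → Models m Γ → Models m Γ'

open Refines

Refines-refl : {VAR : Set} {Γ : Theory VAR} → Refines Γ Γ
Refines-refl = record { models-weaker = λ _ → id ; crisp-stronger = λ _ _ → id }

Refines-∪ : {VAR : Set} {Γ Γ' : Theory VAR} {φ φ' : Formula VAR}
          → Refines Γ Γ'
          → (∀ m → eval m φ' ≡ v1 → eval m φ ≡ v1)
          → (∀ m → IsCrisp m → eval m φ ≡ v1 → eval m φ' ≡ v1)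
          → Refines (Γ ∪｛ φ ｝) (Γ' ∪｛ φ' ｝)
Refines-∪ {Γ = Γ} {Γ'} {φ} {φ'} r φ'⇒φ φ⇒φ'-crisp = record
  { models-weaker  = weaker
  ; crisp-stronger = stronger
  }
  where
  weaker : ∀ m → Models m (Γ' ∪｛ φ' ｝) → Models m (Γ ∪｛ φ ｝)
  weaker m ⊨Γ'φ' ψ (inj₁ ψ∈Γ) = models-weaker r m (λ χ → ⊨Γ'φ' χ ∘ inj₁) ψ ψ∈Γ
  weaker m ⊨Γ'φ' ψ (inj₂ refl) = φ'⇒φ m (⊨Γ'φ' φ' (inj₂ refl))

  stronger : ∀ m → IsCrisp m → Models m (Γ ∪｛ φ ｝) → Models m (Γ' ∪｛ φ' ｝)
  stronger m c ⊨Γφ ψ (inj₁ ψ∈Γ') = crisp-stronger r m c (λ χ → ⊨Γφ χ ∘ inj₁) ψ ψ∈Γ'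
  stronger m c ⊨Γφ ψ (inj₂ refl) = φ⇒φ'-crisp m c (⊨Γφ φ (inj₂ refl))

Refines-∪-same : {VAR : Set} {Γ Γ' : Theory VAR} (φ : Formula VAR)
               → Refines Γ Γ' → Refines (Γ ∪｛ φ ｝) (Γ' ∪｛ φ ｝)
Refines-∪-same φ r = Refines-∪ r (λ _ → id) (λ _ _ → id)

¬¬-intro3 : ∀ a → a ≡ v1 → imp3 (imp3 a v0) v0 ≡ v1
¬¬-intro3 v1 refl = refl

¬¬-elim3 : ∀ a → a ≡ crisp3 a → imp3 (imp3 a v0) v0 ≡ v1 → a ≡ v1
¬¬-elim3 v1 _ _ = refl

Refines-∪-¬¬atom-atom : {VAR : Set} {Γ Γ' : Theory VAR} (x : VAR)
                      → Refines Γ Γ' → Refines (Γ ∪｛ ¬f (¬f atom x) ｝) (Γ' ∪｛ atom x ｝)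
Refines-∪-¬¬atom-atom x r =
  Refines-∪ r (λ m → ¬¬-intro3 (m x)) (λ m c → ¬¬-elim3 (m x) (c x))

Satisfiable-Refines : {VAR : Set} {Γ Γ' : Theory VAR}
                    → Refines Γ Γ' → Satisfiable Γ → Satisfiable Γ'
Satisfiable-Refines r (m , c , ⊨Γ , minimal) =
  m , c , crisp-stronger r m c ⊨Γ ,
  λ { (m' , m'◁m , ⊨Γ') → minimal (m' , m'◁m , models-weaker r m' ⊨Γ') }

FSat-Refines-SSat : {VAR : Set} (qs : List (Quant × VAR)) {Γ Γ' : Theory VAR}
                  → Refines Γ Γ' → FSat qs Γ → SSat qs Γ'
FSat-Refines-SSat []               r sat         = Satisfiable-Refines r sat
FSat-Refines-SSat ((∃q , x) ∷ qs) r (inj₁ sat) =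
  inj₁ (FSat-Refines-SSat qs (Refines-∪-¬¬atom-atom x r) sat)
FSat-Refines-SSat ((∃q , x) ∷ qs) r (inj₂ sat) =
  inj₂ (FSat-Refines-SSat qs (Refines-∪-same (¬f atom x) r) sat)
FSat-Refines-SSat ((∀q , x) ∷ qs) r (sat⁺ , sat⁻) =
  FSat-Refines-SSat qs (Refines-∪-¬¬atom-atom x r) sat⁺ ,
  FSat-Refines-SSat qs (Refines-∪-same (¬f atom x) r) sat⁻

corollary2 : {VAR : Set} → VAR → (qs : List (Quant × VAR)) (Γ : Theory VAR)
             → FSat qs Γ → SSat qs Γ
corollary2 _ qs Γ = FSat-Refines-SSat qs Refines-refl
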